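{- Let $\pi$ be a simple permutation of size $n \geq 4$, and let $S_{\pi+}$ be the set of simple permutations $\sigma$ of size $n+1$ such that $\pi \preceq \sigma$. Then $|S_{\pi+}| = (n+1)(n-3)$.
   Context: A permutation of size $n$ is a bijection $\sigma$ of $\{1,\dots,n\}$, written $\sigma=\sigma_1\cdots\sigma_n$. A permutation $\pi$ of size $k$ is a pattern of $\sigma$, written $\pi \preceq \sigma$, if there exist indices $i_1<\dots<i_k$ with $\sigma_{i_1}\cdots\sigma_{i_k}$ order-isomorphic to $\pi$. An interval of $\sigma$ is a set of consecutive positions $\{i,\dots,j\}$ such that $\{\sigma_i,\dots,\sigma_j\}$ is a set of consecutive integers; $\sigma$ is simple if its only intervals are singletons and the whole set of positions. -}

module Defs where

open import Data.Nat using (ℕ; _∸_; _+_)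
open import Data.Fin using (Fin; toℕ; _<_; _≤_)
open import Data.Vec using (Vec; lookup)
open import Data.List using (List; length)
open import Data.List.Membership.Propositional using (_∈_)
open import Data.List.Relation.Unary.All using (All)
open import Data.List.Relation.Unary.Unique.Propositional using (Unique)
open import Data.Product using (Σ; ∃; _×_)
open import Data.Sum using (_⊎_)
open import Function.Bundles using (_⇔_)
open import Relation.Binary.PropositionalEquality using (_≡_)

-- A permutation of size m, written σ = σ₁⋯σₘ as the vector of its values
-- (values and positions are 0-indexed elements of Fin m); it must be a
-- bijection of Fin m, i.e. injective (equivalently bijective, m finite).
IsPerm : {m : ℕ} → Vec (Fin m) m → Set
IsPerm {m} σ = ∀ (i j : Fin m) → lookup σ i ≡ lookup σ j → i ≡ j

_≼_ : {k m : ℕ} → Vec (Fin k) k → Vec (Fin m) m → Set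
_≼_ {k} {m} π σ =
  Σ (Fin k → Fin m) λ f →
    (∀ (a b : Fin k) → a < b → f a < f b) ×
    (∀ (a b : Fin k) → (lookup π a < lookup π b) ⇔ (lookup σ (f a) < lookup σ (f b)))

-- The positions {i,…,j} (i ≤ j) form an interval of σ: the set of values
-- {σ_i,…,σ_j} is a set of consecutive integers, i.e. every value lying
-- between two of these values is itself one of them.
IsInterval : {m : ℕ} → Vec (Fin m) m → Fin m → Fin m → Set
IsInterval {m} σ i j =
  i ≤ j ×
  (∀ (p q : Fin m) (v : Fin m) →
     i ≤ p → p ≤ j → i ≤ q → q ≤ j →
     lookup σ p ≤ v → v ≤ lookup σ q →
     ∃ λ l → i ≤ l × l ≤ j × lookup σ l ≡ v)

IsSimple : {m : ℕ} → Vec (Fin m) m → Set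
IsSimple {m} σ =
  ∀ (i j : Fin m) → IsInterval σ i j →
    i ≡ j ⊎ (toℕ i ≡ 0 × toℕ j ≡ m ∸ 1)

HasCard : {m : ℕ} → (Vec (Fin m) m → Set) → ℕ → Set
HasCard {m} P c =
  Σ (List (Vec (Fin m) m)) λ L →
    Unique L × All P L × (∀ σ → P σ → σ ∈ L) × length L ≡ c

-- Deleting from σ the points outside a pattern occurrence of π leaves one extra point, so every σ
-- of size n + 1 containing π is π with one point (p, v) inserted: positions ≥ p move right and
-- values ≥ v move up. Since π is simple, an interval of σ that avoids or splits the new point
-- restricts to an interval of π, so σ is simple exactly when the new point neither sits in a corner
-- at the first or last position nor has a value adjacent to that of a horizontal neighbour. For
-- each of the n + 1 positions this forbids four values, pairwise distinct because π is simple, and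
-- leaves n − 3. Admissible insertions at different positions give different permutations, since
-- otherwise the value inserted at the smaller position would be adjacent to a neighbour's.

module Submission where

open import Defs
open import Data.Nat using (ℕ; suc; _≤_; _*_; _∸_)
open import Data.Fin using (Fin)
open import Data.Vec using (Vec)
open import Data.Product using (_×_)

open import Data.Nat using (zero; pred; _+_; _<_; _≟_; _<?_; z≤n; s≤s)
open import Data.Nat.Properties
open import Data.Bool using (true; false)
open import Data.Product using (∃; ∃₂; _,_; proj₁; proj₂)
open import Data.Sum using (_⊎_; inj₁; inj₂)
open import Data.Empty using (⊥; ⊥-elim)
open import Data.Fin using (toℕ; fromℕ<; punchOut)
open import Data.Fin.Properties using (toℕ<n; toℕ-fromℕ<; toℕ-injective; pigeonhole; any?; punchOut-injective)
import Data.Fin.Properties as Fin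
open import Data.Vec using (lookup; tabulate)
open import Data.Vec.Properties using (lookup∘tabulate; tabulate∘lookup; tabulate-cong)
open import Data.List using (List; []; _∷_; _++_; length; filter; map; allFin)
open import Data.List.Properties using (length-++; length-map; length-tabulate)
open import Data.List.Membership.Propositional using (_∈_; _∉_)
open import Data.List.Membership.Propositional.Properties
  using (∈-++⁺ˡ; ∈-++⁺ʳ; ∈-++⁻; ∈-filter⁺; ∈-filter⁻; ∈-map⁺; ∈-map⁻; ∈-allFin)
open import Data.List.Membership.Propositional.Properties.WithK using (unique∧set⇒bag)
open import Data.List.Membership.DecPropositional _≟_ using (_∈?_)
open import Data.List.Relation.Binary.BagAndSetEquality using (∼bag⇒↭)
open import Data.List.Relation.Binary.Permutation.Propositional.Properties using (↭-length)
open import Data.List.Relation.Unary.Any using (here; there)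
open import Data.List.Relation.Unary.All using (All; []; _∷_)
import Data.List.Relation.Unary.All as All
import Data.List.Relation.Unary.All.Properties as All
open import Data.List.Relation.Unary.AllPairs using ([]; _∷_)
open import Data.List.Relation.Unary.Unique.Propositional using (Unique)
import Data.List.Relation.Unary.Unique.Propositional.Properties as Unique
open import Function using (id)
open import Function.Bundles using (mk⇔; Equivalence)
open import Relation.Nullary using (¬_; Dec; yes; no; ¬?; does)
open import Relation.Unary using (Decidable)
open import Relation.Binary.Definitions using (tri<; tri≈; tri>)
open import Relation.Binary.PropositionalEquality

-- Punching in and out on ℕ, as Data.Fin.punchIn and punchOut do on Fin

punchInℕ : ℕ → ℕ → ℕ
punchInℕ v x with x <? v
... | yes _ = x
... | no _ = suc x

punchOutℕ : ℕ → ℕ → ℕ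
punchOutℕ p i with i <? p
... | yes _ = i
... | no _ = pred i

module _ {v x : ℕ} where

  punchInℕ-cases : (x < v × punchInℕ v x ≡ x) ⊎ (v ≤ x × punchInℕ v x ≡ suc x)
  punchInℕ-cases with x <? v
  ... | yes x<v = inj₁ (x<v , refl)
  ... | no x≮v = inj₂ (≮⇒≥ x≮v , refl)

  punchInℕ-< : x < v → punchInℕ v x ≡ x
  punchInℕ-< x<v with punchInℕ-cases
  ... | inj₁ (_ , eq) = eq
  ... | inj₂ (v≤x , _) = ⊥-elim (<⇒≱ x<v v≤x)

  punchInℕ-≥ : v ≤ x → punchInℕ v x ≡ suc x
  punchInℕ-≥ v≤x with punchInℕ-cases
  ... | inj₁ (x<v , _) = ⊥-elim (<⇒≱ x<v v≤x)
  ... | inj₂ (_ , eq) = eq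

  punchInℕ≢ : punchInℕ v x ≢ v
  punchInℕ≢ with punchInℕ-cases
  ... | inj₁ (x<v , eq) = λ e → <⇒≢ x<v (trans (sym eq) e)
  ... | inj₂ (v≤x , eq) = λ e → <⇒≢ (s≤s v≤x) (sym (trans (sym eq) e))

  x≤punchInℕ : x ≤ punchInℕ v x
  x≤punchInℕ with punchInℕ-cases
  ... | inj₁ (_ , eq) = ≤-reflexive (sym eq)
  ... | inj₂ (_ , eq) = ≤-trans (n≤1+n x) (≤-reflexive (sym eq))

  punchInℕ≤suc : punchInℕ v x ≤ suc x
  punchInℕ≤suc with punchInℕ-cases
  ... | inj₁ (_ , eq) = ≤-trans (≤-reflexive eq) (n≤1+n x)
  ... | inj₂ (_ , eq) = ≤-reflexive eq

  punchInℕ-bound : ∀ {n} → x < n → punchInℕ v x < suc n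
  punchInℕ-bound x<n = ≤-<-trans punchInℕ≤suc (s≤s x<n)

punchInℕ-near : ∀ v x → punchInℕ v x ≡ x ⊎ punchInℕ v x ≡ suc x
punchInℕ-near v x with punchInℕ-cases {v} {x}
... | inj₁ (_ , eq) = inj₁ eq
... | inj₂ (_ , eq) = inj₂ eq

module _ (v : ℕ) where

  punchInℕ-mono-< : ∀ {x y} → x < y → punchInℕ v x < punchInℕ v y
  punchInℕ-mono-< {x} {y} x<y with punchInℕ-cases {v} {x} | punchInℕ-cases {v} {y}
  ... | inj₁ (_ , ex) | inj₁ (_ , ey) rewrite ex | ey = x<y
  ... | inj₁ (_ , ex) | inj₂ (_ , ey) rewrite ex | ey = m<n⇒m<1+n x<y
  ... | inj₂ (v≤x , _) | inj₁ (y<v , _) = ⊥-elim (<⇒≱ (<-trans x<y y<v) v≤x)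
  ... | inj₂ (_ , ex) | inj₂ (_ , ey) rewrite ex | ey = s≤s x<y

  punchInℕ-mono-≤ : ∀ {x y} → x ≤ y → punchInℕ v x ≤ punchInℕ v y
  punchInℕ-mono-≤ x≤y with m≤n⇒m<n∨m≡n x≤y
  ... | inj₁ x<y = <⇒≤ (punchInℕ-mono-< x<y)
  ... | inj₂ refl = ≤-refl

  punchInℕ-cancel-< : ∀ {x y} → punchInℕ v x < punchInℕ v y → x < y
  punchInℕ-cancel-< {x} {y} lt with <-cmp x y
  ... | tri< x<y _ _ = x<y
  ... | tri≈ _ refl _ = ⊥-elim (n≮n _ lt)
  ... | tri> _ _ y<x = ⊥-elim (<-asym lt (punchInℕ-mono-< y<x))

  punchInℕ-injective : ∀ {x y} → punchInℕ v x ≡ punchInℕ v y → x ≡ y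
  punchInℕ-injective {x} {y} eq with <-cmp x y
  ... | tri< x<y _ _ = ⊥-elim (<⇒≢ (punchInℕ-mono-< x<y) eq)
  ... | tri≈ _ x≡y _ = x≡y
  ... | tri> _ _ y<x = ⊥-elim (<⇒≢ (punchInℕ-mono-< y<x) (sym eq))

module _ {p i : ℕ} where

  punchOutℕ-< : i < p → punchOutℕ p i ≡ i
  punchOutℕ-< i<p with i <? p
  ... | yes _ = refl
  ... | no i≮p = ⊥-elim (i≮p i<p)

  punchOutℕ-> : p < i → punchOutℕ p i ≡ pred i
  punchOutℕ-> p<i with i <? p
  ... | yes i<p = ⊥-elim (<-asym p<i i<p)
  ... | no _ = refl

  punchInℕ-punchOutℕ : i ≢ p → punchInℕ p (punchOutℕ p i) ≡ i
  punchInℕ-punchOutℕ i≢p with <-cmp i p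
  ... | tri< i<p _ _ rewrite punchOutℕ-< i<p = punchInℕ-< i<p
  ... | tri≈ _ i≡p _ = ⊥-elim (i≢p i≡p)
  ... | tri> _ _ (s≤s p≤i′) rewrite punchOutℕ-> (s≤s p≤i′) = punchInℕ-≥ p≤i′

  punchOutℕ-bound : ∀ {n} → p ≤ n → i ≤ n → i ≢ p → punchOutℕ p i < n
  punchOutℕ-bound p≤n i≤n i≢p with <-cmp i p
  ... | tri< i<p _ _ rewrite punchOutℕ-< i<p = <-≤-trans i<p p≤n
  ... | tri≈ _ i≡p _ = ⊥-elim (i≢p i≡p)
  ... | tri> _ _ (s≤s p≤i′) rewrite punchOutℕ-> (s≤s p≤i′) = i≤n

punchOutℕ-punchInℕ : ∀ p k → punchOutℕ p (punchInℕ p k) ≡ k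
punchOutℕ-punchInℕ p k with punchInℕ-cases {p} {k}
... | inj₁ (k<p , eq) rewrite eq = punchOutℕ-< k<p
... | inj₂ (p≤k , eq) rewrite eq = punchOutℕ-> (s≤s p≤k)

-- Permutations, intervals and simple permutations as functions on ℕ

IsIntervalℕ : (ℕ → ℕ) → ℕ → ℕ → Set
IsIntervalℕ F i j = ∀ p q w → i ≤ p → p ≤ j → i ≤ q → q ≤ j → F p ≤ w → w ≤ F q →
  ∃ λ l → i ≤ l × l ≤ j × F l ≡ w

IsSimpleℕ : ℕ → (ℕ → ℕ) → Set
IsSimpleℕ m F = ∀ i j → i ≤ j → j < m → IsIntervalℕ F i j → i ≡ j ⊎ (i ≡ 0 × suc j ≡ m)

record IsPermℕ (m : ℕ) (F : ℕ → ℕ) : Set where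
  field
    bounded    : ∀ k → k < m → F k < m
    injective  : ∀ a b → a < m → b < m → F a ≡ F b → a ≡ b
    surjective : ∀ w → w < m → ∃ λ k → k < m × F k ≡ w

AgreeBelow : ℕ → (ℕ → ℕ) → (ℕ → ℕ) → Set
AgreeBelow m F G = ∀ k → k < m → F k ≡ G k

Adjacent : ℕ → ℕ → Set
Adjacent a b = b ≡ suc a ⊎ a ≡ suc b

Extreme : ℕ → ℕ → Set
Extreme m x = x ≡ 0 ⊎ suc x ≡ m

isInterval-cong : ∀ {m F G i j} → AgreeBelow m F G → j < m → IsIntervalℕ F i j → IsIntervalℕ G i j
isInterval-cong F≗G j<m int p q w i≤p p≤j i≤q q≤j Gp≤w w≤Gq
  with int p q w i≤p p≤j i≤q q≤j
         (subst (_≤ w) (sym (F≗G p (≤-<-trans p≤j j<m))) Gp≤w)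
         (subst (w ≤_) (sym (F≗G q (≤-<-trans q≤j j<m))) w≤Gq)
... | l , i≤l , l≤j , Fl≡w = l , i≤l , l≤j , trans (sym (F≗G l (≤-<-trans l≤j j<m))) Fl≡w

isSimple-cong : ∀ {m F G} → AgreeBelow m F G → IsSimpleℕ m F → IsSimpleℕ m G
isSimple-cong F≗G S i j i≤j j<m int =
  S i j i≤j j<m (isInterval-cong (λ k k<m → sym (F≗G k k<m)) j<m int)

isPermℕ-cong : ∀ {m F G} → AgreeBelow m F G → IsPermℕ m F → IsPermℕ m G
isPermℕ-cong {m} {F} {G} F≗G P = record { bounded = bounded ; injective = injective ; surjective = surjective }
  where
  module P = IsPermℕ P
  bounded : ∀ k → k < m → G k < m
  bounded k k<m = subst (_< m) (F≗G k k<m) (P.bounded k k<m)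
  injective : ∀ a b → a < m → b < m → G a ≡ G b → a ≡ b
  injective a b a<m b<m eq = P.injective a b a<m b<m (trans (F≗G a a<m) (trans eq (sym (F≗G b b<m))))
  surjective : ∀ w → w < m → ∃ λ k → k < m × G k ≡ w
  surjective w w<m with P.surjective w w<m
  ... | k , k<m , Fk≡w = k , k<m , trans (sym (F≗G k k<m)) Fk≡w

between-suc : ∀ {x p} → x ≤ p → p ≤ suc x → p ≡ x ⊎ p ≡ suc x
between-suc x≤p p≤1+x with m≤n⇒m<n∨m≡n p≤1+x
... | inj₁ (s≤s p≤x) = inj₁ (≤-antisym p≤x x≤p)
... | inj₂ p≡1+x = inj₂ p≡1+x

squeeze-suc : ∀ {a w b} → a ≤ w → w ≤ b → b ≤ suc a → w ≡ a ⊎ w ≡ b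
squeeze-suc a≤w w≤b b≤1+a with between-suc a≤w (≤-trans w≤b b≤1+a)
... | inj₁ w≡a = inj₁ w≡a
... | inj₂ refl = inj₂ (≤-antisym w≤b b≤1+a)

adjacent-close : ∀ {a b} → Adjacent a b → b ≤ suc a × a ≤ suc b
adjacent-close (inj₁ refl) = ≤-refl , m≤n⇒m≤1+n (n≤1+n _)
adjacent-close (inj₂ refl) = m≤n⇒m≤1+n (n≤1+n _) , ≤-refl

adjacent⇒isInterval : ∀ F k → Adjacent (F k) (F (suc k)) → IsIntervalℕ F k (suc k)
adjacent⇒isInterval F k adj p q w k≤p p≤k+1 k≤q q≤k+1 Fp≤w w≤Fq
  with squeeze-suc Fp≤w w≤Fq (close (between-suc k≤p p≤k+1) (between-suc k≤q q≤k+1))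
  where
  close : ∀ {p q} → p ≡ k ⊎ p ≡ suc k → q ≡ k ⊎ q ≡ suc k → F q ≤ suc (F p)
  close (inj₁ refl) (inj₁ refl) = n≤1+n _
  close (inj₁ refl) (inj₂ refl) = proj₁ (adjacent-close adj)
  close (inj₂ refl) (inj₁ refl) = proj₂ (adjacent-close adj)
  close (inj₂ refl) (inj₂ refl) = n≤1+n _
... | inj₁ refl = p , k≤p , p≤k+1 , refl
... | inj₂ refl = q , k≤q , q≤k+1 , refl

isInterval⇒adjacent : ∀ F k → F k ≢ F (suc k) → IsIntervalℕ F k (suc k) → Adjacent (F k) (F (suc k))
isInterval⇒adjacent F k Fk≢ int with <-cmp (F k) (F (suc k))
... | tri≈ _ Fk≡ _ = ⊥-elim (Fk≢ Fk≡)
... | tri< Fk< _ _ with int k (suc k) (suc (F k)) ≤-refl (n≤1+n k) (n≤1+n k) ≤-refl (n≤1+n _) Fk<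
...   | l , k≤l , l≤k+1 , Fl≡ with between-suc k≤l l≤k+1
...     | inj₁ refl = ⊥-elim (1+n≢n (sym Fl≡))
...     | inj₂ refl = inj₁ Fl≡
isInterval⇒adjacent F k Fk≢ int | tri> _ _ Fk>
  with int (suc k) k (suc (F (suc k))) (n≤1+n k) ≤-refl ≤-refl (n≤1+n k) (n≤1+n _) Fk>
...   | l , k≤l , l≤k+1 , Fl≡ with between-suc k≤l l≤k+1
...     | inj₁ refl = inj₂ Fl≡
...     | inj₂ refl = ⊥-elim (1+n≢n (sym Fl≡))

module _ {m : ℕ} {F : ℕ → ℕ} (P : IsPermℕ m F) where
  open IsPermℕ P

  -- The positions in [i, j] carry every value except the extreme value F e, so no value between two of
  -- theirs is missing.
  complement-isInterval : ∀ {e i j} → e < m → Extreme m (F e) → j < m →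
    (∀ k → i ≤ k → k ≤ j → k ≢ e) → (∀ k → k < m → k ≢ e → i ≤ k × k ≤ j) → IsIntervalℕ F i j
  complement-isInterval {e} {i} {j} e<m ext j<m outside inside p q w i≤p p≤j i≤q q≤j Fp≤w w≤Fq =
    inInterval (surjective w (≤-<-trans w≤Fq (bounded q q<m)))
    where
    p<m = ≤-<-trans p≤j j<m
    q<m = ≤-<-trans q≤j j<m
    w≢Fe : Extreme m (F e) → w ≢ F e
    w≢Fe (inj₁ Fe≡0) w≡Fe = outside p i≤p p≤j (injective p e p<m e<m
            (trans (n≤0⇒n≡0 (≤-trans Fp≤w (≤-reflexive (trans w≡Fe Fe≡0)))) (sym Fe≡0)))
    w≢Fe (inj₂ 1+Fe≡m) w≡Fe = outside q i≤q q≤j (injective q e q<m e<m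
            (≤-antisym (≤-pred (≤-trans (bounded q q<m) (≤-reflexive (sym 1+Fe≡m))))
                       (≤-trans (≤-reflexive (sym w≡Fe)) w≤Fq)))
    inInterval : (∃ λ k → k < m × F k ≡ w) → ∃ λ l → i ≤ l × l ≤ j × F l ≡ w
    inInterval (k , k<m , Fk≡w) =
      let i≤k , k≤j = inside k k<m (λ k≡e → w≢Fe ext (trans (sym Fk≡w) (cong F k≡e))) in k , i≤k , k≤j , Fk≡w

  simple⇒first-notExtreme : 3 ≤ m → IsSimpleℕ m F → ¬ Extreme m (F 0)
  simple⇒first-notExtreme (s≤s (s≤s (s≤s {n = m′} _))) S ext
    with S 1 (suc (suc m′)) (s≤s z≤n) ≤-refl (complement-isInterval (s≤s z≤n) ext ≤-refl outside inside)
    where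
    outside : ∀ k → 1 ≤ k → k ≤ suc (suc m′) → k ≢ 0
    outside _ (s≤s _) _ ()
    inside : ∀ k → k < m → k ≢ 0 → 1 ≤ k × k ≤ suc (suc m′)
    inside zero _ 0≢0 = ⊥-elim (0≢0 refl)
    inside (suc k) (s≤s k<) _ = s≤s z≤n , k<
  ... | inj₁ ()
  ... | inj₂ (() , _)

  simple⇒last-notExtreme : 3 ≤ m → IsSimpleℕ m F → ¬ Extreme m (F (pred m))
  simple⇒last-notExtreme (s≤s (s≤s (s≤s {n = m′} _))) S ext
    with S 0 (suc m′) z≤n (n≤1+n _) (complement-isInterval ≤-refl ext (n≤1+n _) outside inside)
    where
    outside : ∀ k → 0 ≤ k → k ≤ suc m′ → k ≢ suc (suc m′)
    outside k _ k≤ k≡ = 1+n≰n (subst (_≤ suc m′) k≡ k≤)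
    inside : ∀ k → k < m → k ≢ suc (suc m′) → 0 ≤ k × k ≤ suc m′
    inside k k<m k≢ = z≤n , ≤-pred (≤∧≢⇒< (≤-pred k<m) k≢)
  ... | inj₁ ()
  ... | inj₂ (_ , e) = 1+n≢n (sym e)

simple⇒¬adjacent : ∀ {m F k} → 3 ≤ m → IsSimpleℕ m F → suc k < m → ¬ Adjacent (F k) (F (suc k))
simple⇒¬adjacent {F = F} {k} (s≤s (s≤s (s≤s _))) S k+1<m adj
  with S k (suc k) (n≤1+n k) k+1<m (adjacent⇒isInterval F k adj)
... | inj₁ k≡k+1 = 1+n≢n (sym k≡k+1)
... | inj₂ (refl , ())

adjacent-sym : ∀ {a b} → Adjacent a b → Adjacent b a
adjacent-sym (inj₁ b≡1+a) = inj₂ b≡1+a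
adjacent-sym (inj₂ a≡1+b) = inj₁ a≡1+b

punchInℕ-adjacent : ∀ {v w} → v ≡ w ⊎ v ≡ suc w → Adjacent v (punchInℕ v w)
punchInℕ-adjacent (inj₁ refl) = inj₁ (punchInℕ-≥ ≤-refl)
punchInℕ-adjacent (inj₂ refl) = inj₂ (cong suc (sym (punchInℕ-< ≤-refl)))

adjacent-punchInℕ⁻ : ∀ {v w} → Adjacent v (punchInℕ v w) → v ≡ w ⊎ v ≡ suc w
adjacent-punchInℕ⁻ {v} {w} adj with punchInℕ-cases {v} {w} | adj
... | inj₁ (w<v , eq) | inj₁ e = ⊥-elim (<⇒≱ w<v (≤-trans (n≤1+n v) (≤-reflexive (sym (trans (sym eq) e)))))
... | inj₁ (w<v , eq) | inj₂ e = inj₂ (trans e (cong suc eq))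
... | inj₂ (v≤w , eq) | inj₁ e = inj₁ (sym (suc-injective (trans (sym eq) e)))
... | inj₂ (v≤w , eq) | inj₂ e =
  ⊥-elim (<⇒≱ (≤-trans (s≤s (n≤1+n w)) (≤-reflexive (sym (trans e (cong suc eq))))) v≤w)

Increasing : ℕ → (ℕ → ℕ) → Set
Increasing m F = ∀ a b → a < b → b < m → F a < F b

agreeBelow-suc : ∀ {m F G} → AgreeBelow m F G → F m ≡ G m → AgreeBelow (suc m) F G
agreeBelow-suc {m} F≗G Fm≡Gm k k<1+m with m≤n⇒m<n∨m≡n (≤-pred k<1+m)
... | inj₁ k<m = F≗G k k<m
... | inj₂ refl = Fm≡Gm

increasing-top⇒id : ∀ m {F p₀} → Increasing (suc m) F → AgreeBelow m F (punchInℕ p₀) → F m ≤ m →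
  AgreeBelow (suc m) F id
increasing-top⇒id zero _ _ F0≤0 = agreeBelow-suc (λ _ ()) (n≤0⇒n≡0 F0≤0)
increasing-top⇒id (suc m) {F} {p₀} inc F≗ F[1+m]≤1+m =
  agreeBelow-suc below (≤-antisym F[1+m]≤1+m (subst (_< F (suc m)) Fm≡m Fm<F[1+m]))
  where
  Fm<F[1+m] = inc m (suc m) ≤-refl ≤-refl
  m<p₀ : m < p₀
  m<p₀ with punchInℕ-cases {p₀} {m}
  ... | inj₁ (m<p₀ , _) = m<p₀
  ... | inj₂ (_ , eq) =
    ⊥-elim (1+n≰n (≤-pred (≤-trans (subst (_< F (suc m)) (trans (F≗ m ≤-refl) eq) Fm<F[1+m]) F[1+m]≤1+m)))
  Fm≡m : F m ≡ m
  Fm≡m = trans (F≗ m ≤-refl) (punchInℕ-< m<p₀)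
  below : AgreeBelow (suc m) F id
  below k k<1+m = trans (F≗ k k<1+m) (punchInℕ-< (≤-<-trans (≤-pred k<1+m) m<p₀))

increasing⇒punchIn : ∀ m {F} → Increasing m F → (∀ a → a < m → F a ≤ m) →
  ∃ λ p → p ≤ m × AgreeBelow m F (punchInℕ p)
increasing⇒punchIn zero _ _ = 0 , z≤n , λ _ ()
increasing⇒punchIn (suc m) {F} inc bnd
  with increasing⇒punchIn m (λ a b a<b b<m → inc a b a<b (m<n⇒m<1+n b<m))
         (λ a a<m → ≤-pred (<-≤-trans (inc a m a<m ≤-refl) (bnd m ≤-refl)))
... | p₀ , p₀≤m , F≗ with m≤n⇒m<n∨m≡n (bnd m ≤-refl)
...   | inj₂ Fm≡1+m = p₀ , m≤n⇒m≤1+n p₀≤m , agreeBelow-suc F≗ (trans Fm≡1+m (sym (punchInℕ-≥ p₀≤m)))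
...   | inj₁ (s≤s Fm≤m) =
  suc m , ≤-refl , λ k k<1+m → trans (increasing-top⇒id m inc F≗ Fm≤m k k<1+m) (sym (punchInℕ-< k<1+m))

increasing⇒id : ∀ m {F} → Increasing m F → (∀ a → a < m → F a < m) → AgreeBelow m F id
increasing⇒id m inc bnd k k<m with increasing⇒punchIn m inc (λ a a<m → <⇒≤ (bnd a a<m))
increasing⇒id (suc m) inc bnd k k<1+m | p , _ , F≗ with punchInℕ-cases {p} {m}
... | inj₁ (m<p , _) = trans (F≗ k k<1+m) (punchInℕ-< (≤-<-trans (≤-pred k<1+m) m<p))
... | inj₂ (_ , eq) = ⊥-elim (<-irrefl (trans (F≗ m ≤-refl) eq) (bnd m ≤-refl))

module _ {m : ℕ} {F : ℕ → ℕ} (P : IsPermℕ m F) where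
  open IsPermℕ P

  inverse : ℕ → ℕ
  inverse w with w <? m
  ... | yes w<m = proj₁ (surjective w w<m)
  ... | no _ = 0

  inverse-spec : ∀ {w} → w < m → inverse w < m × F (inverse w) ≡ w
  inverse-spec {w} w<m with w <? m
  ... | yes w<m′ = proj₂ (surjective w w<m′)
  ... | no w≮m = ⊥-elim (w≮m w<m)

  -- G ∘ F⁻¹ is increasing on [0, m), hence the identity.
  orderPreserving⇒agree : ∀ {G} → (∀ a → a < m → G a < m) →
    (∀ a b → a < m → b < m → F a < F b → G a < G b) → AgreeBelow m G F
  orderPreserving⇒agree {G} G< mono a a<m = begin
      G a                ≡⟨ cong G (injective a (inverse (F a)) a<m (proj₁ spec) (sym (proj₂ spec))) ⟩
      G (inverse (F a))  ≡⟨ increasing⇒id m increasing bounded′ (F a) (bounded a a<m) ⟩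
      F a                ∎
    where
    open ≡-Reasoning
    spec = inverse-spec (bounded a a<m)
    increasing : Increasing m (λ w → G (inverse w))
    increasing u w u<w w<m =
      mono _ _ (proj₁ specᵤ) (proj₁ specᵥ) (subst₂ _<_ (sym (proj₂ specᵤ)) (sym (proj₂ specᵥ)) u<w)
      where
      specᵤ = inverse-spec (<-trans u<w w<m)
      specᵥ = inverse-spec w<m
    bounded′ : ∀ w → w < m → G (inverse w) < m
    bounded′ w w<m = G< _ (proj₁ (inverse-spec w<m))

pair-∈ : ∀ {v a b : ℕ} → v ≡ a ⊎ v ≡ b → v ∈ a ∷ b ∷ []
pair-∈ (inj₁ refl) = here refl
pair-∈ (inj₂ refl) = there (here refl)

pair-∈⁻ : ∀ {v a b : ℕ} → v ∈ a ∷ b ∷ [] → v ≡ a ⊎ v ≡ b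
pair-∈⁻ (here v≡a) = inj₁ v≡a
pair-∈⁻ (there (here v≡b)) = inj₂ v≡b

extreme⇒∈ : ∀ {m v} → Extreme (suc m) v → v ∈ 0 ∷ m ∷ []
extreme⇒∈ (inj₁ v≡0) = here v≡0
extreme⇒∈ (inj₂ 1+v≡1+m) = there (here (suc-injective 1+v≡1+m))

∈⇒extreme : ∀ {m v} → v ∈ 0 ∷ m ∷ [] → Extreme (suc m) v
∈⇒extreme (here v≡0) = inj₁ v≡0
∈⇒extreme (there (here v≡m)) = inj₂ (cong suc v≡m)

unique4 : ∀ {a b c d : ℕ} → a ≢ b → a ≢ c → a ≢ d → b ≢ c → b ≢ d → c ≢ d →
  Unique (a ∷ b ∷ c ∷ d ∷ [])
unique4 a≢b a≢c a≢d b≢c b≢d c≢d =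
  (a≢b ∷ a≢c ∷ a≢d ∷ []) ∷ (b≢c ∷ b≢d ∷ []) ∷ (c≢d ∷ []) ∷ [] ∷ []

map-filter : ∀ {A B : Set} (g : A → B) {P : B → Set} (P? : Decidable P) xs →
  map g (filter (λ x → P? (g x)) xs) ≡ filter P? (map g xs)
map-filter g P? [] = refl
map-filter g P? (x ∷ xs) with does (P? (g x))
... | true = cong (g x ∷_) (map-filter g P? xs)
... | false = map-filter g P? xs

-- Removing the elements of ys from xs leaves a list that together with ys is a permutation of xs.
length-filter-∉ : ∀ {xs ys} → Unique xs → Unique ys → (∀ {y} → y ∈ ys → y ∈ xs) →
  length (filter (λ x → ¬? (x ∈? ys)) xs) + length ys ≡ length xs
length-filter-∉ {xs} {ys} xs! ys! ys⊆xs =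
  trans (sym (length-++ rest)) (↭-length (∼bag⇒↭ (unique∧set⇒bag rest++ys! xs! (mk⇔ to from))))
  where
  notIn? : Decidable (_∉ ys)
  notIn? x = ¬? (x ∈? ys)
  rest = filter notIn? xs
  rest++ys! : Unique (rest ++ ys)
  rest++ys! = Unique.++⁺ (Unique.filter⁺ notIn? xs!) ys!
    (λ (x∈rest , x∈ys) → proj₂ (∈-filter⁻ notIn? {xs = xs} x∈rest) x∈ys)
  to : ∀ {x} → x ∈ rest ++ ys → x ∈ xs
  to x∈ with ∈-++⁻ rest x∈
  ... | inj₁ x∈rest = proj₁ (∈-filter⁻ notIn? {xs = xs} x∈rest)
  ... | inj₂ x∈ys = ys⊆xs x∈ys
  from : ∀ {x} → x ∈ xs → x ∈ rest ++ ys
  from {x} x∈xs with x ∈? ys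
  ... | yes x∈ys = ∈-++⁺ʳ rest x∈ys
  ... | no x∉ys = ∈-++⁺ˡ (∈-filter⁺ notIn? x∈xs x∉ys)

-- From vectors over Fin to functions on ℕ

fromℕ<-view : ∀ {m k} → k < m → ∃ λ (K : Fin m) → toℕ K ≡ k
fromℕ<-view k<m = fromℕ< k<m , toℕ-fromℕ< k<m

-- f read as a function on ℕ, with junk value 0 outside [0, k).
liftℕ : ∀ {k m} → (Fin k → Fin m) → ℕ → ℕ
liftℕ {k} f i with i <? k
... | yes i<k = toℕ (f (fromℕ< i<k))
... | no _ = 0

module _ {k m : ℕ} (f : Fin k → Fin m) where

  liftℕ-toℕ : ∀ i → liftℕ f (toℕ i) ≡ toℕ (f i)
  liftℕ-toℕ i with toℕ i <? k
  ... | yes i<k = cong (λ j → toℕ (f j)) (Fin.fromℕ<-toℕ i i<k)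
  ... | no i≮k = ⊥-elim (i≮k (toℕ<n i))

  liftℕ-bounded : ∀ i → i < k → liftℕ f i < m
  liftℕ-bounded i i<k with fromℕ<-view i<k
  ... | I , refl = subst (_< m) (sym (liftℕ-toℕ I)) (toℕ<n _)

-- A missed point y would make punchOut y ∘ f an injection of Fin m into Fin (m ∸ 1).
injective⇒surjective : ∀ {m} (f : Fin m → Fin m) → (∀ i j → f i ≡ f j → i ≡ j) → ∀ y → ∃ λ x → f x ≡ y
injective⇒surjective {suc m} f f-injective y with any? (λ x → f x Fin.≟ y)
... | yes hit = hit
... | no miss = ⊥-elim (collision (pigeonhole (n<1+n m) (λ x → punchOut (y≢f x))))
  where
  y≢f : ∀ x → y ≢ f x
  y≢f x y≡fx = miss (x , sym y≡fx)
  collision : ¬ ∃₂ λ i j → toℕ i < toℕ j × punchOut (y≢f i) ≡ punchOut (y≢f j)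
  collision (i , j , i<j , eq) = <⇒≢ i<j (cong toℕ (f-injective i j (punchOut-injective (y≢f i) (y≢f j) eq)))

module _ {m : ℕ} (σ : Vec (Fin m) m) where

  isInterval⇒isIntervalℕ : ∀ {I J} → IsInterval σ I J → IsIntervalℕ (liftℕ (lookup σ)) (toℕ I) (toℕ J)
  isInterval⇒isIntervalℕ {I} {J} (_ , body) p q w i≤p p≤j i≤q q≤j σp≤w w≤σq
    with fromℕ<-view (≤-<-trans p≤j (toℕ<n J)) | fromℕ<-view (≤-<-trans q≤j (toℕ<n J))
  ... | P , refl | Q , refl with fromℕ<-view (≤-<-trans w≤σq (liftℕ-bounded (lookup σ) q (≤-<-trans q≤j (toℕ<n J))))
  ...   | W , refl with body P Q W i≤p p≤j i≤q q≤j
                          (subst (_≤ toℕ W) (liftℕ-toℕ (lookup σ) P) σp≤w)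
                          (subst (toℕ W ≤_) (liftℕ-toℕ (lookup σ) Q) w≤σq)
  ...     | L , i≤L , L≤j , σL≡W = toℕ L , i≤L , L≤j , trans (liftℕ-toℕ (lookup σ) L) (cong toℕ σL≡W)

  isIntervalℕ⇒isInterval : ∀ {I J} → toℕ I ≤ toℕ J → IsIntervalℕ (liftℕ (lookup σ)) (toℕ I) (toℕ J) →
    IsInterval σ I J
  isIntervalℕ⇒isInterval {I} {J} i≤j int = i≤j , λ P Q V i≤P P≤j i≤Q Q≤j σP≤V V≤σQ →
    lift (int (toℕ P) (toℕ Q) (toℕ V) i≤P P≤j i≤Q Q≤j
              (subst (_≤ toℕ V) (sym (liftℕ-toℕ (lookup σ) P)) σP≤V)
              (subst (toℕ V ≤_) (sym (liftℕ-toℕ (lookup σ) Q)) V≤σQ))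
    where
    lift : ∀ {V} → (∃ λ l → toℕ I ≤ l × l ≤ toℕ J × liftℕ (lookup σ) l ≡ toℕ V) →
      ∃ λ L → toℕ I ≤ toℕ L × toℕ L ≤ toℕ J × lookup σ L ≡ V
    lift (l , i≤l , l≤j , σl≡) with fromℕ<-view (≤-<-trans l≤j (toℕ<n J))
    ... | L , refl = L , i≤l , l≤j , toℕ-injective (trans (sym (liftℕ-toℕ (lookup σ) L)) σl≡)

  isSimple⇒isSimpleℕ : IsSimple σ → IsSimpleℕ m (liftℕ (lookup σ))
  isSimple⇒isSimpleℕ S i j i≤j j<m int with fromℕ<-view (≤-<-trans i≤j j<m) | fromℕ<-view j<m
  ... | I , refl | J , refl with S I J (isIntervalℕ⇒isInterval i≤j int)
  ...   | inj₁ I≡J = inj₁ (cong toℕ I≡J)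
  ...   | inj₂ (I≡0 , J≡m∸1) = inj₂ (I≡0 , suc-of-∸1 j<m J≡m∸1)
    where
    suc-of-∸1 : ∀ {j m} → j < m → j ≡ m ∸ 1 → suc j ≡ m
    suc-of-∸1 {m = suc _} _ refl = refl

  isSimpleℕ⇒isSimple : IsSimpleℕ m (liftℕ (lookup σ)) → IsSimple σ
  isSimpleℕ⇒isSimple S I J int with S (toℕ I) (toℕ J) (proj₁ int) (toℕ<n J) (isInterval⇒isIntervalℕ int)
  ... | inj₁ I≡J = inj₁ (toℕ-injective I≡J)
  ... | inj₂ (I≡0 , 1+J≡m) = inj₂ (I≡0 , ∸1-of-suc 1+J≡m)
    where
    ∸1-of-suc : ∀ {j m} → suc j ≡ m → j ≡ m ∸ 1
    ∸1-of-suc refl = refl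

  isPerm⇒isPermℕ : IsPerm σ → IsPermℕ m (liftℕ (lookup σ))
  isPerm⇒isPermℕ σ-injective = record
    { bounded = liftℕ-bounded (lookup σ) ; injective = injective ; surjective = surjective }
    where
    injective : ∀ a b → a < m → b < m → liftℕ (lookup σ) a ≡ liftℕ (lookup σ) b → a ≡ b
    injective a b a<m b<m eq with fromℕ<-view a<m | fromℕ<-view b<m
    ... | A , refl | B , refl = cong toℕ (σ-injective A B
            (toℕ-injective (trans (sym (liftℕ-toℕ (lookup σ) A)) (trans eq (liftℕ-toℕ (lookup σ) B)))))
    surjective : ∀ w → w < m → ∃ λ k → k < m × liftℕ (lookup σ) k ≡ w
    surjective w w<m with fromℕ<-view w<m
    ... | W , refl with injective⇒surjective (lookup σ) σ-injective W
    ...   | K , σK≡W = toℕ K , toℕ<n K , trans (liftℕ-toℕ (lookup σ) K) (cong toℕ σK≡W)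

  isPermℕ⇒isPerm : IsPermℕ m (liftℕ (lookup σ)) → IsPerm σ
  isPermℕ⇒isPerm P i j σi≡σj = toℕ-injective (IsPermℕ.injective P _ _ (toℕ<n i) (toℕ<n j)
    (trans (liftℕ-toℕ (lookup σ) i) (trans (cong toℕ σi≡σj) (sym (liftℕ-toℕ (lookup σ) j)))))

-- One-point extensions

module Extension {n : ℕ} {π : ℕ → ℕ} (πPerm : IsPermℕ n π) where
  open IsPermℕ πPerm renaming (bounded to π-bounded; injective to π-injective; surjective to π-surjective)

  extend : ℕ → ℕ → ℕ → ℕ
  extend p v i with i ≟ p
  ... | yes _ = v
  ... | no _ = punchInℕ v (π (punchOutℕ p i))

  extend-at : ∀ p v → extend p v p ≡ v
  extend-at p v with p ≟ p
  ... | yes _ = refl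
  ... | no p≢p = ⊥-elim (p≢p refl)

  extend-≢ : ∀ {p v i} → i ≢ p → extend p v i ≡ punchInℕ v (π (punchOutℕ p i))
  extend-≢ {p} {v} {i} i≢p with i ≟ p
  ... | yes i≡p = ⊥-elim (i≢p i≡p)
  ... | no _ = refl

  extend-punchIn : ∀ p v k → extend p v (punchInℕ p k) ≡ punchInℕ v (π k)
  extend-punchIn p v k =
    trans (extend-≢ {p} {v} (punchInℕ≢ {p} {k})) (cong (λ i → punchInℕ v (π i)) (punchOutℕ-punchInℕ p k))

  extend-left : ∀ k v → extend (suc k) v k ≡ punchInℕ v (π k)
  extend-left k v = trans (cong (extend (suc k) v) (sym (punchInℕ-< {suc k} {k} ≤-refl))) (extend-punchIn (suc k) v k)

  extend-right : ∀ p v → extend p v (suc p) ≡ punchInℕ v (π p)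
  extend-right p v = trans (cong (extend p v) (sym (punchInℕ-≥ {p} {p} ≤-refl))) (extend-punchIn p v p)

  extend≢v : ∀ {p v i} → i ≢ p → extend p v i ≢ v
  extend≢v i≢p eq = punchInℕ≢ (trans (sym (extend-≢ i≢p)) eq)

  extend-isPerm : ∀ {p v} → p ≤ n → v ≤ n → IsPermℕ (suc n) (extend p v)
  extend-isPerm {p} {v} p≤n v≤n = record { bounded = bounded ; injective = injective ; surjective = surjective }
    where
    bounded : ∀ i → i < suc n → extend p v i < suc n
    bounded i i<1+n with i ≟ p
    ... | yes _ = s≤s v≤n
    ... | no i≢p = punchInℕ-bound (π-bounded _ (punchOutℕ-bound p≤n (≤-pred i<1+n) i≢p))

    injective : ∀ a b → a < suc n → b < suc n → extend p v a ≡ extend p v b → a ≡ b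
    injective a b a<1+n b<1+n eq = cases (a ≟ p) (b ≟ p)
      where
      cases : Dec (a ≡ p) → Dec (b ≡ p) → a ≡ b
      cases (yes a≡p) (yes b≡p) = trans a≡p (sym b≡p)
      cases (yes a≡p) (no b≢p) = ⊥-elim (extend≢v b≢p (trans (sym eq) (trans (cong (extend p v) a≡p) (extend-at p v))))
      cases (no a≢p) (yes b≡p) = ⊥-elim (extend≢v a≢p (trans eq (trans (cong (extend p v) b≡p) (extend-at p v))))
      cases (no a≢p) (no b≢p) = begin
          a                                ≡⟨ sym (punchInℕ-punchOutℕ a≢p) ⟩
          punchInℕ p (punchOutℕ p a)       ≡⟨ cong (punchInℕ p) (π-injective _ _
                                                (punchOutℕ-bound p≤n (≤-pred a<1+n) a≢p)
                                                (punchOutℕ-bound p≤n (≤-pred b<1+n) b≢p)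
                                                (punchInℕ-injective v (trans (sym (extend-≢ a≢p)) (trans eq (extend-≢ b≢p))))) ⟩
          punchInℕ p (punchOutℕ p b)       ≡⟨ punchInℕ-punchOutℕ b≢p ⟩
          b                                ∎
        where open ≡-Reasoning

    surjective : ∀ w → w < suc n → ∃ λ k → k < suc n × extend p v k ≡ w
    surjective w w<1+n with w ≟ v
    ... | yes w≡v = p , s≤s p≤n , trans (extend-at p v) (sym w≡v)
    ... | no w≢v with π-surjective (punchOutℕ v w) (punchOutℕ-bound v≤n (≤-pred w<1+n) w≢v)
    ...   | k , k<n , πk≡ = punchInℕ p k , punchInℕ-bound k<n ,
              trans (extend-punchIn p v k) (trans (cong (punchInℕ v) πk≡) (punchInℕ-punchOutℕ w≢v))

  restrict-isInterval : ∀ {p v i j i′ j′} → p ≤ n → j ≤ n → j′ < n →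
    (∀ k → k < n → i′ ≤ k → k ≤ j′ → i ≤ punchInℕ p k × punchInℕ p k ≤ j) →
    (∀ k → k < n → i ≤ punchInℕ p k → punchInℕ p k ≤ j → i′ ≤ k × k ≤ j′) →
    IsIntervalℕ (extend p v) i j → IsIntervalℕ π i′ j′
  restrict-isInterval {p} {v} {i} {j} {i′} {j′} p≤n j≤n j′<n to from int
                      a b w i′≤a a≤j′ i′≤b b≤j′ πa≤w w≤πb =
    pullBack (int (punchInℕ p a) (punchInℕ p b) (punchInℕ v w)
                  (proj₁ a∈) (proj₂ a∈) (proj₁ b∈) (proj₂ b∈)
                  (subst (_≤ punchInℕ v w) (sym (extend-punchIn p v a)) (punchInℕ-mono-≤ v πa≤w))
                  (subst (punchInℕ v w ≤_) (sym (extend-punchIn p v b)) (punchInℕ-mono-≤ v w≤πb)))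
    where
    a∈ = to a (≤-<-trans a≤j′ j′<n) i′≤a a≤j′
    b∈ = to b (≤-<-trans b≤j′ j′<n) i′≤b b≤j′
    pullBack : (∃ λ l → i ≤ l × l ≤ j × extend p v l ≡ punchInℕ v w) →
      ∃ λ k → i′ ≤ k × k ≤ j′ × π k ≡ w
    pullBack (l , i≤l , l≤j , σl≡) = k , proj₁ k∈ , proj₂ k∈ , πk≡w
      where
      l≢p : l ≢ p
      l≢p l≡p = punchInℕ≢ (sym (trans (sym (extend-at p v)) (trans (cong (extend p v) (sym l≡p)) σl≡)))
      k = punchOutℕ p l
      pk≡l : punchInℕ p k ≡ l
      pk≡l = punchInℕ-punchOutℕ l≢p
      k∈ = from k (punchOutℕ-bound p≤n (≤-trans l≤j j≤n) l≢p)
             (subst (i ≤_) (sym pk≡l) i≤l) (subst (_≤ j) (sym pk≡l) l≤j)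
      πk≡w : π k ≡ w
      πk≡w = punchInℕ-injective v (trans (sym (extend-punchIn p v k)) (trans (cong (extend p v) pk≡l) σl≡))

  -- v ∸ 1 and v + 1 occur off position p, hence inside [i, j], but v itself occurs only at p.
  complement-¬isInterval : ∀ {p v i j} → v ≤ n → ¬ Extreme (suc n) v →
    (∀ l → l ≤ n → l ≢ p → i ≤ l × l ≤ j) → (∀ l → i ≤ l → l ≤ j → l ≢ p) →
    ¬ IsIntervalℕ (extend p v) i j
  complement-¬isInterval {v = zero} _ notExtreme _ _ _ = notExtreme (inj₁ refl)
  complement-¬isInterval {p} {suc u} {i} {j} v≤n notExtreme inside outside int =
    avoid (int P Q (suc u) (proj₁ P∈) (proj₂ P∈) (proj₁ Q∈) (proj₂ Q∈)
               (≤-trans (≤-reflexive σP≡) (n≤1+n u)) (≤-trans (n≤1+n (suc u)) (≤-reflexive (sym σQ≡))))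
    where
    v<n = ≤∧≢⇒< v≤n (λ v≡n → notExtreme (inj₂ (cong suc v≡n)))
    below = π-surjective u (<-trans (n<1+n u) v<n)
    above = π-surjective (suc u) v<n
    P = punchInℕ p (proj₁ below)
    Q = punchInℕ p (proj₁ above)
    P∈ = inside P (≤-pred (punchInℕ-bound (proj₁ (proj₂ below)))) punchInℕ≢
    Q∈ = inside Q (≤-pred (punchInℕ-bound (proj₁ (proj₂ above)))) punchInℕ≢
    σP≡ : extend p (suc u) P ≡ u
    σP≡ = trans (extend-punchIn p _ _) (trans (cong (punchInℕ (suc u)) (proj₂ (proj₂ below))) (punchInℕ-< ≤-refl))
    σQ≡ : extend p (suc u) Q ≡ suc (suc u)
    σQ≡ = trans (extend-punchIn p _ _) (trans (cong (punchInℕ (suc u)) (proj₂ (proj₂ above))) (punchInℕ-≥ ≤-refl))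
    avoid : ¬ ∃ λ l → i ≤ l × l ≤ j × extend p (suc u) l ≡ suc u
    avoid (l , i≤l , l≤j , σl≡) = extend≢v (outside l i≤l l≤j) σl≡

  record Admissible (p v : ℕ) : Set where
    field
      atStart     : p ≡ 0 → ¬ Extreme (suc n) v
      atEnd       : p ≡ n → ¬ Extreme (suc n) v
      afterLeft   : ∀ k → p ≡ suc k → ¬ (v ≡ π k ⊎ v ≡ suc (π k))
      beforeRight : p < n → ¬ (v ≡ π p ⊎ v ≡ suc (π p))

  isInterval-withRight⇒near : ∀ {p v} → IsIntervalℕ (extend p v) p (suc p) → v ≡ π p ⊎ v ≡ suc (π p)
  isInterval-withRight⇒near {p} {v} int =
    adjacent-punchInℕ⁻ (subst₂ Adjacent (extend-at p v) (extend-right p v) (isInterval⇒adjacent (extend p v) p σp≢ int))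
    where
    σp≢ : extend p v p ≢ extend p v (suc p)
    σp≢ eq = punchInℕ≢ (trans (sym (extend-right p v)) (trans (sym eq) (extend-at p v)))

  isInterval-withLeft⇒near : ∀ {k v} → IsIntervalℕ (extend (suc k) v) k (suc k) → v ≡ π k ⊎ v ≡ suc (π k)
  isInterval-withLeft⇒near {k} {v} int = adjacent-punchInℕ⁻ (adjacent-sym
    (subst₂ Adjacent (extend-left k v) (extend-at (suc k) v) (isInterval⇒adjacent (extend (suc k) v) k σk≢ int)))
    where
    σk≢ : extend (suc k) v k ≢ extend (suc k) v (suc k)
    σk≢ eq = punchInℕ≢ (trans (sym (extend-left k v)) (trans eq (extend-at (suc k) v)))

  module _ (πSimple : IsSimpleℕ n π) {p v : ℕ} (p≤n : p ≤ n) (v≤n : v ≤ n) (adm : Admissible p v) where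
    open Admissible adm

    isInterval-after : ∀ {i j} → p < i → i < j → j ≤ n → ¬ IsIntervalℕ (extend p v) i j
    isInterval-after {suc i₀} {suc j₀} (s≤s p≤i₀) (s≤s i₀<j₀) j≤n int =
      conclude (πSimple i₀ j₀ (<⇒≤ i₀<j₀) j≤n (restrict-isInterval p≤n j≤n j≤n to from int))
      where
      to : ∀ k → k < n → i₀ ≤ k → k ≤ j₀ → suc i₀ ≤ punchInℕ p k × punchInℕ p k ≤ suc j₀
      to k _ i₀≤k k≤j₀ rewrite punchInℕ-≥ {p} {k} (≤-trans p≤i₀ i₀≤k) = s≤s i₀≤k , s≤s k≤j₀
      from : ∀ k → k < n → suc i₀ ≤ punchInℕ p k → punchInℕ p k ≤ suc j₀ → i₀ ≤ k × k ≤ j₀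
      from k _ lo hi with punchInℕ-cases {p} {k}
      ... | inj₁ (k<p , eq) = ⊥-elim (<⇒≱ (≤-trans (subst (suc i₀ ≤_) eq lo) (<⇒≤ k<p)) p≤i₀)
      ... | inj₂ (_ , eq) = ≤-pred (subst (suc i₀ ≤_) eq lo) , ≤-pred (subst (_≤ suc j₀) eq hi)
      conclude : i₀ ≡ j₀ ⊎ (i₀ ≡ 0 × suc j₀ ≡ n) → ⊥
      conclude (inj₁ i₀≡j₀) = <-irrefl i₀≡j₀ i₀<j₀
      conclude (inj₂ (i₀≡0 , 1+j₀≡n)) = complement-¬isInterval v≤n (atStart p≡0) inside outside int
        where
        p≡0 = n≤0⇒n≡0 (≤-trans p≤i₀ (≤-reflexive i₀≡0))
        inside : ∀ l → l ≤ n → l ≢ p → suc i₀ ≤ l × l ≤ suc j₀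
        inside zero _ 0≢p = ⊥-elim (0≢p (sym p≡0))
        inside (suc l) 1+l≤n _ = s≤s (subst (_≤ l) (sym i₀≡0) z≤n) , ≤-trans 1+l≤n (≤-reflexive (sym 1+j₀≡n))
        outside : ∀ l → suc i₀ ≤ l → l ≤ suc j₀ → l ≢ p
        outside l 1+i₀≤l _ l≡p = <⇒≢ (≤-trans (s≤s z≤n) 1+i₀≤l) (sym (trans l≡p p≡0))

    isInterval-before : ∀ {i j} → i < j → j < p → ¬ IsIntervalℕ (extend p v) i j
    isInterval-before {i} {j} i<j j<p int =
      conclude (πSimple i j (<⇒≤ i<j) j<n (restrict-isInterval p≤n (<⇒≤ j<n) j<n to from int))
      where
      j<n = <-≤-trans j<p p≤n
      to : ∀ k → k < n → i ≤ k → k ≤ j → i ≤ punchInℕ p k × punchInℕ p k ≤ j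
      to k _ i≤k k≤j rewrite punchInℕ-< {p} {k} (≤-<-trans k≤j j<p) = i≤k , k≤j
      from : ∀ k → k < n → i ≤ punchInℕ p k → punchInℕ p k ≤ j → i ≤ k × k ≤ j
      from k _ lo hi with punchInℕ-cases {p} {k}
      ... | inj₁ (_ , eq) = subst (i ≤_) eq lo , subst (_≤ j) eq hi
      ... | inj₂ (p≤k , eq) = ⊥-elim (<⇒≱ (≤-<-trans (subst (_≤ j) eq hi) j<p) (m≤n⇒m≤1+n p≤k))
      conclude : i ≡ j ⊎ (i ≡ 0 × suc j ≡ n) → ⊥
      conclude (inj₁ i≡j) = <-irrefl i≡j i<j
      conclude (inj₂ (i≡0 , 1+j≡n)) = complement-¬isInterval v≤n (atEnd p≡n) inside outside int
        where
        p≡n = ≤-antisym p≤n (subst (_≤ p) 1+j≡n j<p)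
        inside : ∀ l → l ≤ n → l ≢ p → i ≤ l × l ≤ j
        inside l l≤n l≢p = subst (_≤ l) (sym i≡0) z≤n ,
          ≤-pred (subst (l <_) (sym 1+j≡n) (≤∧≢⇒< l≤n (λ l≡n → l≢p (trans l≡n (sym p≡n)))))
        outside : ∀ l → i ≤ l → l ≤ j → l ≢ p
        outside l _ l≤j = <⇒≢ (≤-<-trans l≤j j<p)

    isInterval-across : ∀ {i j} → i ≤ p → p ≤ j → i < j → j ≤ n → IsIntervalℕ (extend p v) i j →
      i ≡ 0 × suc j ≡ suc n
    isInterval-across {i} {suc j₀} i≤p p≤j (s≤s i≤j₀) j≤n int =
      conclude (πSimple i j₀ i≤j₀ j≤n (restrict-isInterval p≤n j≤n j≤n to from int))
      where
      to : ∀ k → k < n → i ≤ k → k ≤ j₀ → i ≤ punchInℕ p k × punchInℕ p k ≤ suc j₀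
      to k _ i≤k k≤j₀ = ≤-trans i≤k x≤punchInℕ , ≤-trans punchInℕ≤suc (s≤s k≤j₀)
      from : ∀ k → k < n → i ≤ punchInℕ p k → punchInℕ p k ≤ suc j₀ → i ≤ k × k ≤ j₀
      from k _ lo hi with punchInℕ-cases {p} {k}
      ... | inj₁ (k<p , eq) = subst (i ≤_) eq lo , ≤-pred (≤-trans k<p p≤j)
      ... | inj₂ (p≤k , eq) = ≤-trans i≤p p≤k , ≤-pred (subst (_≤ suc j₀) eq hi)
      twoPoints : i ≡ j₀ → ⊥
      twoPoints refl with between-suc i≤p p≤j
      ... | inj₁ p≡i = beforeRight (<-≤-trans (≤-reflexive (cong suc p≡i)) j≤n)
              (isInterval-withRight⇒near (subst (λ q → IsIntervalℕ (extend p v) q (suc q)) (sym p≡i) int))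
      ... | inj₂ p≡1+i = afterLeft i p≡1+i
              (isInterval-withLeft⇒near (subst (λ q → IsIntervalℕ (extend q v) i (suc i)) p≡1+i int))
      conclude : i ≡ j₀ ⊎ (i ≡ 0 × suc j₀ ≡ n) → i ≡ 0 × suc (suc j₀) ≡ suc n
      conclude (inj₁ i≡j₀) = ⊥-elim (twoPoints i≡j₀)
      conclude (inj₂ (i≡0 , 1+j₀≡n)) = i≡0 , cong suc 1+j₀≡n

    extend-isSimple : IsSimpleℕ (suc n) (extend p v)
    extend-isSimple i j i≤j j<1+n int with m≤n⇒m<n∨m≡n i≤j
    ... | inj₂ i≡j = inj₁ i≡j
    ... | inj₁ i<j with p <? i | j <? p
    ...   | yes p<i | _ = ⊥-elim (isInterval-after p<i i<j (≤-pred j<1+n) int)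
    ...   | no _ | yes j<p = ⊥-elim (isInterval-before i<j j<p int)
    ...   | no p≮i | no j≮p = inj₂ (isInterval-across (≮⇒≥ p≮i) (≮⇒≥ j≮p) i<j (≤-pred j<1+n) int)

  isSimple⇒admissible : ∀ {p v} → 2 ≤ n → p ≤ n → v ≤ n → IsSimpleℕ (suc n) (extend p v) → Admissible p v
  isSimple⇒admissible {p} {v} n≥2 p≤n v≤n σSimple = record
    { atStart = atStart ; atEnd = atEnd ; afterLeft = afterLeft ; beforeRight = beforeRight }
    where
    σPerm = extend-isPerm p≤n v≤n
    atStart : p ≡ 0 → ¬ Extreme (suc n) v
    atStart refl ext = simple⇒first-notExtreme σPerm (s≤s n≥2) σSimple (subst (Extreme (suc n)) (sym (extend-at 0 v)) ext)
    atEnd : p ≡ n → ¬ Extreme (suc n) v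
    atEnd refl ext = simple⇒last-notExtreme σPerm (s≤s n≥2) σSimple (subst (Extreme (suc n)) (sym (extend-at n v)) ext)
    afterLeft : ∀ k → p ≡ suc k → ¬ (v ≡ π k ⊎ v ≡ suc (π k))
    afterLeft k refl near = simple⇒¬adjacent (s≤s n≥2) σSimple (s≤s p≤n)
      (subst₂ Adjacent (sym (extend-left k v)) (sym (extend-at (suc k) v)) (adjacent-sym (punchInℕ-adjacent near)))
    beforeRight : p < n → ¬ (v ≡ π p ⊎ v ≡ suc (π p))
    beforeRight p<n near = simple⇒¬adjacent (s≤s n≥2) σSimple (s≤s p<n)
      (subst₂ Adjacent (sym (extend-at p v)) (sym (extend-right p v)) (punchInℕ-adjacent near))

  extend-agree⇒near : ∀ {p v p′ v′} → p < p′ → p′ ≤ n → AgreeBelow (suc n) (extend p v) (extend p′ v′) →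
    v ≡ π p ⊎ v ≡ suc (π p)
  extend-agree⇒near {p} {v} {p′} {v′} p<p′ p′≤n σ≗σ′ =
    subst (λ x → x ≡ π p ⊎ x ≡ suc (π p)) (sym v≡) (punchInℕ-near v′ (π p))
    where
    open ≡-Reasoning
    v≡ : v ≡ punchInℕ v′ (π p)
    v≡ = begin
      v                                  ≡⟨ sym (extend-at p v) ⟩
      extend p v p                       ≡⟨ σ≗σ′ p (s≤s (≤-trans (<⇒≤ p<p′) p′≤n)) ⟩
      extend p′ v′ p                     ≡⟨ extend-≢ (<⇒≢ p<p′) ⟩
      punchInℕ v′ (π (punchOutℕ p′ p))   ≡⟨ cong (λ i → punchInℕ v′ (π i)) (punchOutℕ-< p<p′) ⟩
      punchInℕ v′ (π p)                  ∎

  -- f is punchIn p for some p, and σ ∘ f punched out at v = σ p is order-isomorphic to π, hence equal to π.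
  extend-complete : ∀ {σ f} → IsPermℕ (suc n) σ → Increasing n f → (∀ a → a < n → f a < suc n) →
    (∀ a b → a < n → b < n → π a < π b → σ (f a) < σ (f b)) →
    ∃ λ p → ∃ λ v → p ≤ n × v ≤ n × AgreeBelow (suc n) σ (extend p v)
  extend-complete {σ} {f} σPerm f-increasing f< embeds
    with increasing⇒punchIn n f-increasing (λ a a<n → ≤-pred (f< a a<n))
  ... | p , p≤n , f≗ = p , σ p , p≤n , ≤-pred (σ-bounded p (s≤s p≤n)) , σ≗
    where
    open IsPermℕ σPerm renaming (bounded to σ-bounded; injective to σ-injective)
    σ[punchIn]≢ : ∀ {a} → a < n → σ (punchInℕ p a) ≢ σ p
    σ[punchIn]≢ a<n eq = punchInℕ≢ (σ-injective _ _ (punchInℕ-bound a<n) (s≤s p≤n) eq)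
    reduced : ℕ → ℕ
    reduced a = punchOutℕ (σ p) (σ (punchInℕ p a))
    reduced-bounded : ∀ a → a < n → reduced a < n
    reduced-bounded a a<n =
      punchOutℕ-bound (≤-pred (σ-bounded p (s≤s p≤n))) (≤-pred (σ-bounded _ (punchInℕ-bound a<n))) (σ[punchIn]≢ a<n)
    punchIn-reduced : ∀ {a} → a < n → punchInℕ (σ p) (reduced a) ≡ σ (punchInℕ p a)
    punchIn-reduced a<n = punchInℕ-punchOutℕ (σ[punchIn]≢ a<n)
    reduced-mono : ∀ a b → a < n → b < n → π a < π b → reduced a < reduced b
    reduced-mono a b a<n b<n πa<πb = punchInℕ-cancel-< (σ p)
      (subst₂ _<_ (trans (cong σ (f≗ a a<n)) (sym (punchIn-reduced a<n))) (trans (cong σ (f≗ b b<n)) (sym (punchIn-reduced b<n)))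
        (embeds a b a<n b<n πa<πb))
    reduced≗π : AgreeBelow n reduced π
    reduced≗π = orderPreserving⇒agree πPerm reduced-bounded reduced-mono
    σ≗ : AgreeBelow (suc n) σ (extend p (σ p))
    σ≗ k k<1+n = byCases (k ≟ p)
      where
      byCases : Dec (k ≡ p) → σ k ≡ extend p (σ p) k
      byCases (yes refl) = sym (extend-at p (σ p))
      byCases (no k≢p) = begin
          σ k                              ≡⟨ cong σ (sym (punchInℕ-punchOutℕ k≢p)) ⟩
          σ (punchInℕ p k′)                ≡⟨ sym (punchIn-reduced k′<n) ⟩
          punchInℕ (σ p) (reduced k′)      ≡⟨ cong (punchInℕ (σ p)) (reduced≗π k′ k′<n) ⟩
          punchInℕ (σ p) (π k′)            ≡⟨ sym (extend-punchIn p (σ p) k′) ⟩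
          extend p (σ p) (punchInℕ p k′)   ≡⟨ cong (extend p (σ p)) (punchInℕ-punchOutℕ k≢p) ⟩
          extend p (σ p) k                 ∎
        where
        open ≡-Reasoning
        k′ = punchOutℕ p k
        k′<n = punchOutℕ-bound p≤n (≤-pred k<1+n) k≢p

  leftForbidden : ℕ → List ℕ
  leftForbidden zero = 0 ∷ n ∷ []
  leftForbidden (suc k) = π k ∷ suc (π k) ∷ []

  rightForbidden : ℕ → List ℕ
  rightForbidden p with p ≟ n
  ... | yes _ = 0 ∷ n ∷ []
  ... | no _ = π p ∷ suc (π p) ∷ []

  forbidden : ℕ → List ℕ
  forbidden p = leftForbidden p ++ rightForbidden p

  rightForbidden-n : rightForbidden n ≡ 0 ∷ n ∷ []
  rightForbidden-n with n ≟ n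
  ... | yes _ = refl
  ... | no n≢n = ⊥-elim (n≢n refl)

  rightForbidden-< : ∀ {p} → p < n → rightForbidden p ≡ π p ∷ suc (π p) ∷ []
  rightForbidden-< {p} p<n with p ≟ n
  ... | yes p≡n = ⊥-elim (<⇒≢ p<n p≡n)
  ... | no _ = refl

  ∉forbidden⇒admissible : ∀ {p v} → v ∉ forbidden p → Admissible p v
  ∉forbidden⇒admissible {p} {v} v∉ = record
    { atStart = atStart ; atEnd = atEnd ; afterLeft = afterLeft ; beforeRight = beforeRight }
    where
    atStart : p ≡ 0 → ¬ Extreme (suc n) v
    atStart refl ext = v∉ (∈-++⁺ˡ (extreme⇒∈ ext))
    atEnd : p ≡ n → ¬ Extreme (suc n) v
    atEnd refl ext = v∉ (∈-++⁺ʳ (leftForbidden n) (subst (v ∈_) (sym rightForbidden-n) (extreme⇒∈ ext)))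
    afterLeft : ∀ k → p ≡ suc k → ¬ (v ≡ π k ⊎ v ≡ suc (π k))
    afterLeft k refl near = v∉ (∈-++⁺ˡ (pair-∈ near))
    beforeRight : p < n → ¬ (v ≡ π p ⊎ v ≡ suc (π p))
    beforeRight p<n near = v∉ (∈-++⁺ʳ (leftForbidden p) (subst (v ∈_) (sym (rightForbidden-< p<n)) (pair-∈ near)))

  admissible⇒∉forbidden : ∀ {p v} → p ≤ n → Admissible p v → v ∉ forbidden p
  admissible⇒∉forbidden {p} {v} p≤n adm v∈ with ∈-++⁻ (leftForbidden p) v∈
  ... | inj₁ v∈left = left p refl v∈left
    where
    open Admissible adm
    left : ∀ q → p ≡ q → v ∈ leftForbidden q → ⊥
    left zero p≡0 v∈l = atStart p≡0 (∈⇒extreme v∈l)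
    left (suc k) p≡1+k v∈l = afterLeft k p≡1+k (pair-∈⁻ v∈l)
  ... | inj₂ v∈right with m≤n⇒m<n∨m≡n p≤n
  ...   | inj₁ p<n = Admissible.beforeRight adm p<n (pair-∈⁻ (subst (v ∈_) (rightForbidden-< p<n) v∈right))
  ...   | inj₂ refl = Admissible.atEnd adm refl (∈⇒extreme (subst (v ∈_) rightForbidden-n v∈right))

  forbidden-length : ∀ p → length (forbidden p) ≡ 4
  forbidden-length p = trans (length-++ (leftForbidden p)) (cong₂ _+_ (left p) right)
    where
    left : ∀ p → length (leftForbidden p) ≡ 2
    left zero = refl
    left (suc _) = refl
    right : length (rightForbidden p) ≡ 2
    right with p ≟ n
    ... | yes _ = refl
    ... | no _ = refl

  forbidden-bounded : ∀ {p} → p ≤ n → All (_< suc n) (forbidden p)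
  forbidden-bounded {p} p≤n = All.++⁺ (left p p≤n) right
    where
    pair : ∀ {a} → a < n → All (_< suc n) (a ∷ suc a ∷ [])
    pair a<n = m<n⇒m<1+n a<n ∷ s≤s a<n ∷ []
    ends : All (_< suc n) (0 ∷ n ∷ [])
    ends = s≤s z≤n ∷ ≤-refl ∷ []
    left : ∀ q → q ≤ n → All (_< suc n) (leftForbidden q)
    left zero _ = ends
    left (suc k) 1+k≤n = pair (π-bounded k 1+k≤n)
    right : All (_< suc n) (rightForbidden p)
    right with p ≟ n
    ... | yes _ = ends
    ... | no p≢n = pair (π-bounded p (≤∧≢⇒< p≤n p≢n))

  module _ (n≥3 : 3 ≤ n) (πSimple : IsSimpleℕ n π) where

    forbidden-unique : ∀ {p} → p ≤ n → Unique (forbidden p)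
    forbidden-unique {zero} _ =
      subst Unique (cong (leftForbidden 0 ++_) (sym (rightForbidden-< 0<n)))
        (unique4 (<⇒≢ 0<n) (λ 0≡π0 → first (inj₁ (sym 0≡π0))) 0≢1+n
                 (λ n≡π0 → <⇒≢ (π-bounded 0 0<n) (sym n≡π0)) (λ n≡1+π0 → first (inj₂ (sym n≡1+π0)))
                 (<⇒≢ (n<1+n _)))
      where
      0<n = <-trans (s≤s z≤n) n≥3
      first = simple⇒first-notExtreme πPerm n≥3 πSimple
    forbidden-unique {suc k} 1+k≤n with m≤n⇒m<n∨m≡n 1+k≤n
    ... | inj₁ 1+k<n =
      subst Unique (cong (leftForbidden (suc k) ++_) (sym (rightForbidden-< 1+k<n)))
        (unique4 (<⇒≢ (n<1+n _)) πk≢ (λ πk≡ → ¬adjacent (inj₂ πk≡))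
                 (λ 1+πk≡ → ¬adjacent (inj₁ (sym 1+πk≡))) (λ e → πk≢ (suc-injective e)) (<⇒≢ (n<1+n _)))
      where
      πk≢ : π k ≢ π (suc k)
      πk≢ e = <⇒≢ (n<1+n k) (π-injective k (suc k) (<-trans (n<1+n k) 1+k<n) 1+k<n e)
      ¬adjacent = simple⇒¬adjacent n≥3 πSimple 1+k<n
    ... | inj₂ 1+k≡n =
      subst Unique (cong (leftForbidden (suc k) ++_) (sym (trans (cong rightForbidden 1+k≡n) rightForbidden-n)))
        (unique4 (<⇒≢ (n<1+n _)) (λ πk≡0 → last (inj₁ πk≡0)) (<⇒≢ (π-bounded k (≤-reflexive 1+k≡n)))
                 (λ 1+πk≡0 → 0≢1+n (sym 1+πk≡0)) (λ 1+πk≡n → last (inj₂ 1+πk≡n)) (<⇒≢ 0<n))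
      where
      0<n = <-trans (s≤s z≤n) n≥3
      last : ¬ Extreme n (π k)
      last = subst (λ i → ¬ Extreme n (π i)) (cong pred (sym 1+k≡n)) (simple⇒last-notExtreme πPerm n≥3 πSimple)

-- Counting the simple one-point extensions

module Enumeration {n : ℕ} (n≥3 : 3 ≤ n) (π : Vec (Fin n) n) (πPerm : IsPerm π) (πSimple : IsSimple π) where
  πPermℕ = isPerm⇒isPermℕ π πPerm
  πSimpleℕ = isSimple⇒isSimpleℕ π πSimple
  open Extension πPermℕ

  InSπ+ : Vec (Fin (suc n)) (suc n) → Set
  InSπ+ σ = IsPerm σ × IsSimple σ × (π ≼ σ)

  toℕ≤n : (i : Fin (suc n)) → toℕ i ≤ n
  toℕ≤n i = ≤-pred (toℕ<n i)

  extendFin : Fin (suc n) → Fin (suc n) → Fin (suc n) → Fin (suc n)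
  extendFin p v i = fromℕ< (IsPermℕ.bounded (extend-isPerm (toℕ≤n p) (toℕ≤n v)) (toℕ i) (toℕ<n i))

  extendVec : Fin (suc n) → Fin (suc n) → Vec (Fin (suc n)) (suc n)
  extendVec p v = tabulate (extendFin p v)

  toℕ-extendFin : ∀ p v i → toℕ (extendFin p v i) ≡ extend (toℕ p) (toℕ v) (toℕ i)
  toℕ-extendFin p v i = toℕ-fromℕ< (IsPermℕ.bounded (extend-isPerm (toℕ≤n p) (toℕ≤n v)) (toℕ i) (toℕ<n i))

  toℕ-extendVec : ∀ p v i → toℕ (lookup (extendVec p v) i) ≡ extend (toℕ p) (toℕ v) (toℕ i)
  toℕ-extendVec p v i = trans (cong toℕ (lookup∘tabulate (extendFin p v) i)) (toℕ-extendFin p v i)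

  liftℕ-extendVec : ∀ p v → AgreeBelow (suc n) (liftℕ (lookup (extendVec p v))) (extend (toℕ p) (toℕ v))
  liftℕ-extendVec p v k k<1+n with fromℕ<-view k<1+n
  ... | K , refl = trans (liftℕ-toℕ (lookup (extendVec p v)) K) (toℕ-extendVec p v K)

  extendVec-∈Sπ+ : ∀ p v → Admissible (toℕ p) (toℕ v) → InSπ+ (extendVec p v)
  extendVec-∈Sπ+ p v adm = isPerm , isSimple , punchIn-pattern
    where
    σ≗ = λ k k<1+n → sym (liftℕ-extendVec p v k k<1+n)
    isPerm = isPermℕ⇒isPerm (extendVec p v) (isPermℕ-cong σ≗ (extend-isPerm (toℕ≤n p) (toℕ≤n v)))
    isSimple = isSimpleℕ⇒isSimple (extendVec p v) (isSimple-cong σ≗ (extend-isSimple πSimpleℕ (toℕ≤n p) (toℕ≤n v) adm))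
    f : Fin n → Fin (suc n)
    f a = fromℕ< (punchInℕ-bound {toℕ p} {toℕ a} (toℕ<n a))
    toℕ-f : ∀ a → toℕ (f a) ≡ punchInℕ (toℕ p) (toℕ a)
    toℕ-f a = toℕ-fromℕ< (punchInℕ-bound {toℕ p} {toℕ a} (toℕ<n a))
    value : ∀ a → toℕ (lookup (extendVec p v) (f a)) ≡ punchInℕ (toℕ v) (toℕ (lookup π a))
    value a = begin
      toℕ (lookup (extendVec p v) (f a))               ≡⟨ toℕ-extendVec p v (f a) ⟩
      extend (toℕ p) (toℕ v) (toℕ (f a))               ≡⟨ cong (extend (toℕ p) (toℕ v)) (toℕ-f a) ⟩
      extend (toℕ p) (toℕ v) (punchInℕ (toℕ p) (toℕ a)) ≡⟨ extend-punchIn (toℕ p) (toℕ v) (toℕ a) ⟩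
      punchInℕ (toℕ v) (liftℕ (lookup π) (toℕ a))      ≡⟨ cong (punchInℕ (toℕ v)) (liftℕ-toℕ (lookup π) a) ⟩
      punchInℕ (toℕ v) (toℕ (lookup π a))              ∎
      where open ≡-Reasoning
    punchIn-pattern : π ≼ extendVec p v
    punchIn-pattern = f ,
      (λ a b a<b → subst₂ _<_ (sym (toℕ-f a)) (sym (toℕ-f b)) (punchInℕ-mono-< (toℕ p) a<b)) ,
      (λ a b → mk⇔ (λ πa<πb → subst₂ _<_ (sym (value a)) (sym (value b)) (punchInℕ-mono-< (toℕ v) πa<πb))
                   (λ σa<σb → punchInℕ-cancel-< (toℕ v) (subst₂ _<_ (value a) (value b) σa<σb)))

  Good : Fin (suc n) → Fin (suc n) → Set
  Good p v = toℕ v ∉ forbidden (toℕ p)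

  good? : ∀ p → Decidable (Good p)
  good? p v = ¬? (toℕ v ∈? forbidden (toℕ p))

  goodValues : Fin (suc n) → List (Fin (suc n))
  goodValues p = filter (good? p) (allFin (suc n))

  goodValues-length : ∀ p → length (goodValues p) ≡ n ∸ 3
  goodValues-length p = begin
      length (goodValues p)                            ≡⟨ sym (length-map toℕ (goodValues p)) ⟩
      length (map toℕ (goodValues p))                  ≡⟨ cong length (map-filter toℕ notIn? (allFin (suc n))) ⟩
      length (filter notIn? values)                    ≡⟨ sym (m+n∸n≡m _ 4) ⟩
      length (filter notIn? values) + 4 ∸ 4            ≡⟨ cong (λ k → length (filter notIn? values) + k ∸ 4)
                                                            (sym (forbidden-length (toℕ p))) ⟩
      length (filter notIn? values) + length F ∸ 4     ≡⟨ cong (_∸ 4) (length-filter-∉ values! F! F⊆values) ⟩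
      length values ∸ 4                                ≡⟨ cong (_∸ 4) (trans (length-map toℕ (allFin (suc n)))
                                                                            (length-tabulate {n = suc n} id)) ⟩
      suc n ∸ 4                                        ∎
    where
    open ≡-Reasoning
    F = forbidden (toℕ p)
    notIn? : Decidable (_∉ F)
    notIn? x = ¬? (x ∈? F)
    values = map toℕ (allFin (suc n))
    values! : Unique values
    values! = Unique.map⁺ toℕ-injective (Unique.allFin⁺ (suc n))
    F! : Unique F
    F! = forbidden-unique n≥3 πSimpleℕ (toℕ≤n p)
    F⊆values : ∀ {y} → y ∈ F → y ∈ values
    F⊆values y∈F with fromℕ<-view (All.lookup (forbidden-bounded (toℕ≤n p)) y∈F)
    ... | Y , refl = ∈-map⁺ toℕ (∈-allFin Y)

  extensionsAt : Fin (suc n) → List (Vec (Fin (suc n)) (suc n))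
  extensionsAt p = map (extendVec p) (goodValues p)

  extensions : List (Fin (suc n)) → List (Vec (Fin (suc n)) (suc n))
  extensions [] = []
  extensions (p ∷ ps) = extensionsAt p ++ extensions ps

  ∈-extensions⁻ : ∀ {σ} ps → σ ∈ extensions ps → ∃₂ λ p v → p ∈ ps × Good p v × σ ≡ extendVec p v
  ∈-extensions⁻ (p ∷ ps) σ∈ with ∈-++⁻ (extensionsAt p) σ∈
  ... | inj₁ σ∈at with ∈-map⁻ (extendVec p) σ∈at
  ...   | v , v∈ , σ≡ = p , v , here refl , proj₂ (∈-filter⁻ (good? p) {xs = allFin (suc n)} v∈) , σ≡
  ∈-extensions⁻ (p ∷ ps) σ∈ | inj₂ σ∈rest with ∈-extensions⁻ ps σ∈rest
  ...   | p′ , v , p′∈ , good , σ≡ = p′ , v , there p′∈ , good , σ≡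

  ∈-extensions⁺ : ∀ {p v} ps → p ∈ ps → Good p v → extendVec p v ∈ extensions ps
  ∈-extensions⁺ {p} {v} (q ∷ ps) (here refl) good =
    ∈-++⁺ˡ (∈-map⁺ (extendVec p) (∈-filter⁺ (good? p) (∈-allFin v) good))
  ∈-extensions⁺ (q ∷ ps) (there p∈) good = ∈-++⁺ʳ (extensionsAt q) (∈-extensions⁺ ps p∈ good)

  extendVec-agree : ∀ {p v p′ v′} → extendVec p v ≡ extendVec p′ v′ →
    AgreeBelow (suc n) (extend (toℕ p) (toℕ v)) (extend (toℕ p′) (toℕ v′))
  extendVec-agree {p} {v} {p′} {v′} eq k k<1+n = trans (sym (liftℕ-extendVec p v k k<1+n))
    (trans (cong (λ σ → liftℕ (lookup σ) k) eq) (liftℕ-extendVec p′ v′ k k<1+n))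

  extendVec-injectiveʳ : ∀ p {v v′} → extendVec p v ≡ extendVec p v′ → v ≡ v′
  extendVec-injectiveʳ p {v} {v′} eq = toℕ-injective
    (trans (sym (extend-at (toℕ p) (toℕ v))) (trans (extendVec-agree eq (toℕ p) (toℕ<n p)) (extend-at (toℕ p) (toℕ v′))))

  extendVec-distinct : ∀ {p v p′ v′} → p ≢ p′ → Good p v → Good p′ v′ → extendVec p v ≢ extendVec p′ v′
  extendVec-distinct {p} {v} {p′} {v′} p≢p′ good good′ eq with <-cmp (toℕ p) (toℕ p′)
  ... | tri< p<p′ _ _ = Admissible.beforeRight (∉forbidden⇒admissible good) (<-≤-trans p<p′ (toℕ≤n p′))
          (extend-agree⇒near p<p′ (toℕ≤n p′) (extendVec-agree eq))
  ... | tri≈ _ p≡p′ _ = p≢p′ (toℕ-injective p≡p′)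
  ... | tri> _ _ p′<p = Admissible.beforeRight (∉forbidden⇒admissible good′) (<-≤-trans p′<p (toℕ≤n p))
          (extend-agree⇒near p′<p (toℕ≤n p) (extendVec-agree (sym eq)))

  extensions-unique : ∀ ps → Unique ps → Unique (extensions ps)
  extensions-unique [] _ = []
  extensions-unique (p ∷ ps) (p∉ps ∷ ps!) = Unique.++⁺
    (Unique.map⁺ (extendVec-injectiveʳ p) (Unique.filter⁺ (good? p) (Unique.allFin⁺ (suc n))))
    (extensions-unique ps ps!) disjoint
    where
    disjoint : ∀ {σ} → ¬ (σ ∈ extensionsAt p × σ ∈ extensions ps)
    disjoint (σ∈at , σ∈rest) with ∈-map⁻ (extendVec p) σ∈at | ∈-extensions⁻ ps σ∈rest
    ... | v , v∈ , σ≡ | p′ , v′ , p′∈ , good′ , σ≡′ =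
      extendVec-distinct (All.lookup p∉ps p′∈) (proj₂ (∈-filter⁻ (good? p) {xs = allFin (suc n)} v∈)) good′
        (trans (sym σ≡) σ≡′)

  extensions-⊆Sπ+ : ∀ ps → All InSπ+ (extensions ps)
  extensions-⊆Sπ+ ps = All.tabulate λ σ∈ → inSπ+ (∈-extensions⁻ ps σ∈)
    where
    inSπ+ : ∀ {σ} → (∃₂ λ p v → p ∈ ps × Good p v × σ ≡ extendVec p v) → InSπ+ σ
    inSπ+ (p , v , _ , good , refl) = extendVec-∈Sπ+ p v (∉forbidden⇒admissible good)

  extensions-length : ∀ ps → length (extensions ps) ≡ length ps * (n ∸ 3)
  extensions-length [] = refl
  extensions-length (p ∷ ps) = trans (length-++ (extensionsAt p))
    (cong₂ _+_ (trans (length-map (extendVec p) (goodValues p)) (goodValues-length p)) (extensions-length ps))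

  extensions-complete : ∀ σ → InSπ+ σ → σ ∈ extensions (allFin (suc n))
  extensions-complete σ (σPerm , σSimple , f , f-mono , f-iso)
    with extend-complete (isPerm⇒isPermℕ σ σPerm) increasing (liftℕ-bounded f) embeds
    where
    increasing : Increasing n (liftℕ f)
    increasing a b a<b b<n with fromℕ<-view (<-trans a<b b<n) | fromℕ<-view b<n
    ... | A , refl | B , refl = subst₂ _<_ (sym (liftℕ-toℕ f A)) (sym (liftℕ-toℕ f B)) (f-mono A B a<b)
    embeds : ∀ a b → a < n → b < n → liftℕ (lookup π) a < liftℕ (lookup π) b →
      liftℕ (lookup σ) (liftℕ f a) < liftℕ (lookup σ) (liftℕ f b)
    embeds a b a<n b<n πa<πb with fromℕ<-view a<n | fromℕ<-view b<n
    ... | A , refl | B , refl = subst₂ _<_ (σf A) (σf B)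
          (Equivalence.to (f-iso A B) (subst₂ _<_ (liftℕ-toℕ (lookup π) A) (liftℕ-toℕ (lookup π) B) πa<πb))
      where
      σf : ∀ X → toℕ (lookup σ (f X)) ≡ liftℕ (lookup σ) (liftℕ f (toℕ X))
      σf X = sym (trans (cong (liftℕ (lookup σ)) (liftℕ-toℕ f X)) (liftℕ-toℕ (lookup σ) (f X)))
  ... | p , v , p≤n , v≤n , σ≗ with fromℕ<-view (s≤s p≤n) | fromℕ<-view (s≤s v≤n)
  ...   | P , refl | V , refl =
    subst (_∈ extensions (allFin (suc n))) (sym σ≡) (∈-extensions⁺ (allFin (suc n)) (∈-allFin P) good)
    where
    good : Good P V
    good = admissible⇒∉forbidden p≤n (isSimple⇒admissible (<⇒≤ n≥3) p≤n v≤n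
             (isSimple-cong σ≗ (isSimple⇒isSimpleℕ σ σSimple)))
    σ≡ : σ ≡ extendVec P V
    σ≡ = trans (sym (tabulate∘lookup σ)) (tabulate-cong λ i → toℕ-injective
           (trans (sym (liftℕ-toℕ (lookup σ) i)) (trans (σ≗ (toℕ i) (toℕ<n i)) (sym (toℕ-extendFin P V i)))))

  enumeration : HasCard InSπ+ (suc n * (n ∸ 3))
  enumeration = extensions (allFin (suc n)) , extensions-unique (allFin (suc n)) (Unique.allFin⁺ (suc n)) ,
    extensions-⊆Sπ+ (allFin (suc n)) , extensions-complete ,
    trans (extensions-length (allFin (suc n))) (cong (_* (n ∸ 3)) (length-tabulate {n = suc n} id))

proposition4p7 : (n : ℕ) → 4 ≤ n → (π : Vec (Fin n) n) → IsPerm π → IsSimple π →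
    HasCard (λ (σ : Vec (Fin (suc n)) (suc n)) → IsPerm σ × IsSimple σ × (π ≼ σ))
      (suc n * (n ∸ 3))
proposition4p7 n n≥4 = Enumeration.enumeration (<⇒≤ n≥4)
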